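{- Every integer of the form $N=2^n3^m\ge 2$ (with $n,m\ge 0$ integers) is quasi monomially irreducible.
   Context: For an integer $N\ge 2$ and $a_1,\dots,a_n\in\mathbb{Z}/N\mathbb{Z}$, set $M_n(a_1,\dots,a_n)=\begin{pmatrix}a_n&-1\\1&0\end{pmatrix}\cdots\begin{pmatrix}a_1&-1\\1&0\end{pmatrix}\in SL_2(\mathbb{Z}/N\mathbb{Z})$. The equation $(E_N)$ is $M_n(a_1,\dots,a_n)=\pm \mathrm{Id}$; an $n$-tuple satisfying it is a solution of size $n$. Define $(a_1,\dots,a_n)\oplus(b_1,\dots,b_m)=(a_1+b_m,a_2,\dots,a_{n-1},a_n+b_1,b_2,\dots,b_{m-1})$, and $(a_1,\dots,a_n)\sim(b_1,\dots,b_n)$ if $(b_1,\dots,b_n)$ is a cyclic permutation of $(a_1,\dots,a_n)$ or of $(a_n,\dots,a_1)$. A solution $(c_1,\dots,c_n)$ of $(E_N)$ with $n\ge 3$ is reducible if there exist a solution $(b_1,\dots,b_l)$ of $(E_N)$ and an $m$-tuple $(a_1,\dots,a_m)$ with $m\ge3$, $l\ge 3$ and $(c_1,\dots,c_n)\sim(a_1,\dots,a_m)\oplus(b_1,\dots,b_l)$; otherwise irreducible ($(\overline0,\overline0)$ is not irreducible). The $\overline k$-monomial minimal solution of $(E_N)$ is $(\overline k,\dots,\overline k)$ of the least positive length for which it solves $(E_N)$. $N$ is quasi monomially irreducible if for every integer $k$ coprime to $N$ the $\overline k$-monomial minimal solution of $(E_N)$ is irreducible. -}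

module Defs where

open import Data.Nat as ℕ using (ℕ; zero; suc; _≤_; _<_)
open import Data.Nat.Coprimality using (Coprime)
open import Data.Integer as ℤ using (ℤ; +_; _+_; _*_; _-_; -_; ∣_∣)
open import Data.Integer.Divisibility using (_∣_)
open import Data.List using (List; []; _∷_; _++_; length; drop; take; reverse; replicate)
open import Data.List.Relation.Binary.Pointwise using (Pointwise)
open import Data.Maybe using (Maybe; just; nothing)
open import Data.Product using (Σ; _×_; _,_; ∃)
open import Data.Sum using (_⊎_)
open import Relation.Nullary using (¬_)

-- Elements of ℤ/Nℤ are represented by integers, compared modulo N.
_≡[mod_]_ : ℤ → ℕ → ℤ → Set
a ≡[mod N ] b = (+ N) ∣ (a - b)

record Mat : Set where
  constructor mat
  field
    m11 m12 m21 m22 : ℤ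

_⊗_ : Mat → Mat → Mat
mat a b c d ⊗ mat e f g h = mat (a * e + b * g) (a * f + b * h) (c * e + d * g) (c * f + d * h)

Id : Mat
Id = mat (+ 1) (+ 0) (+ 0) (+ 1)

-Id : Mat
-Id = mat (- + 1) (+ 0) (+ 0) (- + 1)

A : ℤ → Mat
A a = mat a (- + 1) (+ 1) (+ 0)

-- M(a₁,…,aₙ) = A(aₙ) ⋯ A(a₁)
Mgo : Mat → List ℤ → Mat
Mgo acc [] = acc
Mgo acc (a ∷ as) = Mgo (A a ⊗ acc) as

Mₙ : List ℤ → Mat
Mₙ = Mgo Id

_≋[mod_]_ : Mat → ℕ → Mat → Set
mat a b c d ≋[mod N ] mat e f g h =
  (a ≡[mod N ] e) × (b ≡[mod N ] f) × (c ≡[mod N ] g) × (d ≡[mod N ] h)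

IsSolution : ℕ → List ℤ → Set
IsSolution N as = (Mₙ as ≋[mod N ] Id) ⊎ (Mₙ as ≋[mod N ] -Id)

unsnoc : List ℤ → Maybe (List ℤ × ℤ)
unsnoc [] = nothing
unsnoc (x ∷ xs) with unsnoc xs
... | nothing = just ([] , x)
... | just (ys , y) = just (x ∷ ys , y)

-- (a₁,…,aₙ) ⊕ (b₁,…,bₘ) = (a₁+bₘ, a₂,…,aₙ₋₁, aₙ+b₁, b₂,…,bₘ₋₁)
-- (only meaningful when both lists have length ≥ 2; otherwise returns [])
_⊕_ : List ℤ → List ℤ → List ℤ
[] ⊕ _ = []
(a₁ ∷ as) ⊕ [] = []
(a₁ ∷ as) ⊕ (b₁ ∷ bs) with unsnoc as | unsnoc bs
... | just (amid , aₙ) | just (bmid , bₘ) = ((a₁ + bₘ) ∷ amid) ++ ((aₙ + b₁) ∷ bmid)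
... | _ | _ = []

rotate : ℕ → List ℤ → List ℤ
rotate k xs = drop k xs ++ take k xs

_∼[mod_]_ : List ℤ → ℕ → List ℤ → Set
c ∼[mod N ] d = Σ ℕ λ k → k < length c ×
  (Pointwise (λ x y → x ≡[mod N ] y) (rotate k c) d
   ⊎ Pointwise (λ x y → x ≡[mod N ] y) (rotate k (reverse c)) d)

Reducible : ℕ → List ℤ → Set
Reducible N c = 3 ≤ length c × IsSolution N c ×
  Σ (List ℤ) λ b → Σ (List ℤ) λ a →
    IsSolution N b × 3 ≤ length b × 3 ≤ length a × (c ∼[mod N ] (a ⊕ b))

Irreducible : ℕ → List ℤ → Set
Irreducible N c = 3 ≤ length c × IsSolution N c × ¬ Reducible N c

IsMonomialMinimal : ℕ → ℤ → ℕ → Set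
IsMonomialMinimal N k n = 1 ≤ n × IsSolution N (replicate n k) ×
  (∀ j → 1 ≤ j → j < n → ¬ IsSolution N (replicate j k))

QuasiMonomiallyIrreducible : ℕ → Set
QuasiMonomiallyIrreducible N = ∀ (k : ℤ) → Coprime ∣ k ∣ N →
  ∀ n → IsMonomialMinimal N k n → Irreducible N (replicate n k)

{-# OPTIONS --safe #-}
-- The monomial word (k,…,k) of length j has matrix
-- [[U (j+1), -U j], [U j, U (j+1) - k U j]], where U (j+2) = k U (j+1) - U j.
-- If the minimal k-monomial solution of length L were a ⊕ b with b a solution,
-- the entries strictly inside b are ≡ k, and the corner of M(b) forces
-- U (j+1) ≡ ±1 for some 1 ≤ j ≤ L - 3.  Cassini's identity
-- U j U (j+2) = U (j+1)² - 1 then gives N ∣ U j U (j+2).  If k ≡ ±1 modulo every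
-- prime divisor p of N (as happens for N = 2^a 3^b), then U is 3-periodic up to
-- sign modulo p with zeros exactly at the multiples of 3, so one of U j, U (j+2)
-- is coprime to N and N divides the other: the monomial word of length j or
-- j + 2 is already a solution, contradicting minimality.
module Submission where

open import Defs
open import Data.Nat using (ℕ; _≤_; _^_; _*_)
import Data.Nat as ℕ
open import Data.Nat using (zero; suc; s≤s; z≤n; NonZero)
import Data.Nat.Properties as ℕP
open import Data.Nat.Divisibility as ℕ∣ using (_∣_)
open import Data.Nat.Coprimality as Coprimality using (Coprime; coprime-divisor)
open import Data.Nat.Primality using (Prime; prime?; ¬prime[1]; prime[2]; prime⇒irreducible; euclidsLemma)
open import Data.Nat.Primality.Factorisation using (factorise)
open import Data.Integer as ℤ using (ℤ; +_; -[1+_]; -_; _+_; _-_; ∣_∣) renaming (_*_ to _·_)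
import Data.Integer.Properties as ℤP
import Data.Integer.Divisibility.Signed as ℤ∣
open import Data.Integer.DivMod using (_%ℕ_; _/ℕ_; n%ℕd<d; a≡a%ℕn+[a/ℕn]*n)
open import Data.Integer.Tactic.RingSolver using (solve-∀)
open import Data.List using ([]; _∷_; _++_; _∷ʳ_; length; replicate; reverse; drop; take)
import Data.List.Properties as ListP
open import Data.List.Reverse using (reverseView; _∶_∶ʳ_)
open import Data.List.Relation.Unary.All as All using (All; []; _∷_)
open import Data.List.Relation.Unary.All.Properties using (++⁻ʳ; replicate⁺)
open import Data.List.Relation.Binary.Pointwise using (Pointwise; []; _∷_)
open import Data.List.Relation.Binary.Pointwise.Properties using (Pointwise-length)
open import Data.List.Relation.Binary.Permutation.Propositional using (_↭_; ↭-reflexive; ↭-sym; ↭-trans)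
open import Data.List.Relation.Binary.Permutation.Propositional.Properties
  using (++-comm; ↭-reverse; ↭-length; All-resp-↭)
open import Data.Maybe using (just)
open import Data.Product using (_×_; _,_; proj₁; proj₂; ∃-syntax)
open import Data.Sum using (_⊎_; inj₁; inj₂; [_,_])
open import Data.Empty using (⊥-elim)
open import Function using (id)
open import Relation.Nullary using (¬_)
open import Relation.Nullary.Decidable using (from-yes)
open import Relation.Binary.PropositionalEquality
  using (_≡_; refl; sym; trans; cong; cong₂; subst; module ≡-Reasoning)

-- Congruences modulo N

-- Unlike _≡[mod_]_, this record lets Agda infer x and y from a proof.
infix 4 _≈_[mod_]
record _≈_[mod_] (x y : ℤ) (N : ℕ) : Set where
  constructor mod
  field
    divides : + N ℤ∣.∣ (x - y)

module _ {N : ℕ} where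

  private
    mod-by : ∀ {x y z} → z ≡ x - y → + N ℤ∣.∣ z → x ≈ y [mod N ]
    mod-by refl = mod

  ≡[mod]⇒≈ : ∀ {x y} → x ≡[mod N ] y → x ≈ y [mod N ]
  ≡[mod]⇒≈ p = mod (ℤ∣.∣ᵤ⇒∣ p)

  ≈⇒≡[mod] : ∀ {x y} → x ≈ y [mod N ] → x ≡[mod N ] y
  ≈⇒≡[mod] (mod d) = ℤ∣.∣⇒∣ᵤ d

  ≈-mod-reflexive : ∀ {x y} → x ≡ y → x ≈ y [mod N ]
  ≈-mod-reflexive {x} refl = mod-by (sym (ℤP.+-inverseʳ x)) (ℤ∣.divides (+ 0) refl)

  ≈-mod-refl : ∀ {x} → x ≈ x [mod N ]
  ≈-mod-refl = ≈-mod-reflexive refl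

  ≈-mod-trans : ∀ {x y z} → x ≈ y [mod N ] → y ≈ z [mod N ] → x ≈ z [mod N ]
  ≈-mod-trans {x} {y} {z} (mod d) (mod e) = mod-by (identity x y z) (ℤ∣.∣m∣n⇒∣m+n d e)
    where
    identity : ∀ x y z → (x - y) + (y - z) ≡ x - z
    identity = solve-∀

  +-cong-mod : ∀ {x y u v} → x ≈ y [mod N ] → u ≈ v [mod N ] → x + u ≈ y + v [mod N ]
  +-cong-mod {x} {y} {u} {v} (mod d) (mod e) = mod-by (identity x y u v) (ℤ∣.∣m∣n⇒∣m+n d e)
    where
    identity : ∀ x y u v → (x - y) + (u - v) ≡ (x + u) - (y + v)
    identity = solve-∀

  -‿cong-mod : ∀ {x y} → x ≈ y [mod N ] → - x ≈ - y [mod N ]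
  -‿cong-mod {x} {y} (mod d) = mod-by (identity x y) (ℤ∣.∣m⇒∣-m d)
    where
    identity : ∀ x y → - (x - y) ≡ (- x) - (- y)
    identity = solve-∀

  ·-cong-mod : ∀ {x y u v} → x ≈ y [mod N ] → u ≈ v [mod N ] → x · u ≈ y · v [mod N ]
  ·-cong-mod {x} {y} {u} {v} (mod d) (mod e) =
    mod-by (identity x y u v) (ℤ∣.∣m∣n⇒∣m+n (ℤ∣.∣m⇒∣m*n u d) (ℤ∣.∣n⇒∣m*n y e))
    where
    identity : ∀ x y u v → (x - y) · u + y · (u - v) ≡ x · u - y · v
    identity = solve-∀

  ≈-mod-0⇒∣ : ∀ {x} → x ≈ + 0 [mod N ] → N ∣ ∣ x ∣
  ≈-mod-0⇒∣ {x} (mod d) = subst (λ z → N ∣ ∣ z ∣) (ℤP.+-identityʳ x) (ℤ∣.∣⇒∣ᵤ d)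

  ∣⇒≈-mod-0 : ∀ {x} → N ∣ ∣ x ∣ → x ≈ + 0 [mod N ]
  ∣⇒≈-mod-0 {x} N∣x = mod-by (sym (ℤP.+-identityʳ x)) (ℤ∣.∣ᵤ⇒∣ N∣x)

  ≈-mod-∣ : ∀ {x y} → x ≈ y [mod N ] → N ∣ ∣ x ∣ → N ∣ ∣ y ∣
  ≈-mod-∣ {x} {y} (mod d) N∣x =
    ℤ∣.∣⇒∣ᵤ (subst (+ N ℤ∣.∣_) (identity x y) (ℤ∣.∣m∣n⇒∣m-n (ℤ∣.∣ᵤ⇒∣ {i = x} N∣x) d))
    where
    identity : ∀ x y → x - (x - y) ≡ y
    identity = solve-∀

unit⇒±1 : ∀ e → ∣ e ∣ ≡ 1 → e ≡ + 1 ⊎ e ≡ - + 1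
unit⇒±1 (+ 1) refl = inj₁ refl
unit⇒±1 -[1+ 0 ] refl = inj₂ refl
unit⇒±1 (+ zero) ()
unit⇒±1 (+ suc (suc _)) ()
unit⇒±1 -[1+ suc _ ] ()

unit-square : ∀ e → ∣ e ∣ ≡ 1 → e · e ≡ + 1
unit-square e u with unit⇒±1 e u
... | inj₁ refl = refl
... | inj₂ refl = refl

unit-neg : ∀ e → ∣ e ∣ ≡ 1 → ∣ - e ∣ ≡ 1
unit-neg e u = trans (ℤP.∣-i∣≡∣i∣ e) u

unit-≈-mod-prime : ∀ {p x e} → Prime p → x ≈ e [mod p ] → ∣ e ∣ ≡ 1 → ¬ p ∣ ∣ x ∣
unit-≈-mod-prime {p} pp x≡e u p∣x =
  ¬prime[1] (subst Prime (ℕ∣.∣1⇒≡1 (subst (p ∣_) u (≈-mod-∣ x≡e p∣x))) pp)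

-- Matrices

mat-≡ : ∀ {a b c d a′ b′ c′ d′} → a ≡ a′ → b ≡ b′ → c ≡ c′ → d ≡ d′ → mat a b c d ≡ mat a′ b′ c′ d′
mat-≡ refl refl refl refl = refl

⊗-assoc : ∀ X Y Z → (X ⊗ Y) ⊗ Z ≡ X ⊗ (Y ⊗ Z)
⊗-assoc (mat a b c d) (mat e f g h) (mat i j k l) =
  mat-≡ (entry a b e f g h i k) (entry a b e f g h j l) (entry c d e f g h i k) (entry c d e f g h j l)
  where
  entry : ∀ a b e f g h i k →
          (a · e + b · g) · i + (a · f + b · h) · k ≡ a · (e · i + f · k) + b · (g · i + h · k)
  entry = solve-∀

⊗-identityˡ : ∀ X → Id ⊗ X ≡ X
⊗-identityˡ (mat a b c d) = mat-≡ (top a c) (top b d) (bottom a c) (bottom b d)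
  where
  top : ∀ a c → + 1 · a + + 0 · c ≡ a
  top = solve-∀
  bottom : ∀ a c → + 0 · a + + 1 · c ≡ c
  bottom = solve-∀

⊗-identityʳ : ∀ X → X ⊗ Id ≡ X
⊗-identityʳ (mat a b c d) = mat-≡ (left a b) (right a b) (left c d) (right c d)
  where
  left : ∀ a b → a · + 1 + b · + 0 ≡ a
  left = solve-∀
  right : ∀ a b → a · + 0 + b · + 1 ≡ b
  right = solve-∀

Mgo-++ : ∀ X xs ys → Mgo X (xs ++ ys) ≡ Mgo (Mgo X xs) ys
Mgo-++ X [] ys = refl
Mgo-++ X (x ∷ xs) ys = Mgo-++ (A x ⊗ X) xs ys

Mgo-⊗ : ∀ X Y xs → Mgo (X ⊗ Y) xs ≡ Mgo X xs ⊗ Y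
Mgo-⊗ X Y [] = refl
Mgo-⊗ X Y (x ∷ xs) = trans (cong (λ Z → Mgo Z xs) (sym (⊗-assoc (A x) X Y))) (Mgo-⊗ (A x ⊗ X) Y xs)

Mₙ-∷ : ∀ x xs → Mₙ (x ∷ xs) ≡ Mₙ xs ⊗ A x
Mₙ-∷ x xs = begin
  Mgo (A x ⊗ Id) xs ≡⟨ cong (λ Z → Mgo Z xs) (trans (⊗-identityʳ (A x)) (sym (⊗-identityˡ (A x)))) ⟩
  Mgo (Id ⊗ A x) xs ≡⟨ Mgo-⊗ Id (A x) xs ⟩
  Mₙ xs ⊗ A x       ∎
  where open ≡-Reasoning

Mₙ-∷ʳ : ∀ xs x → Mₙ (xs ∷ʳ x) ≡ A x ⊗ Mₙ xs
Mₙ-∷ʳ xs x = Mgo-++ Id xs (x ∷ [])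

Mₙ-frame : ∀ b₁ bs bₘ → - Mat.m22 (Mₙ (b₁ ∷ bs ∷ʳ bₘ)) ≡ Mat.m11 (Mₙ bs)
Mₙ-frame b₁ bs bₘ rewrite Mₙ-∷ʳ (b₁ ∷ bs) bₘ | Mₙ-∷ b₁ bs with Mₙ bs
... | mat a b c d = identity a b c d b₁ bₘ
  where
  identity : ∀ a b c d x y → - (+ 1 · (a · (- + 1) + b · + 0) + + 0 · (c · (- + 1) + d · + 0)) ≡ a
  identity = solve-∀

infix 4 _≅_[mod_]
record _≅_[mod_] (X Y : Mat) (N : ℕ) : Set where
  constructor entrywise
  field
    e₁₁ : Mat.m11 X ≈ Mat.m11 Y [mod N ]
    e₁₂ : Mat.m12 X ≈ Mat.m12 Y [mod N ]
    e₂₁ : Mat.m21 X ≈ Mat.m21 Y [mod N ]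
    e₂₂ : Mat.m22 X ≈ Mat.m22 Y [mod N ]

module _ {N : ℕ} where

  ≅-refl : ∀ {X} → X ≅ X [mod N ]
  ≅-refl = entrywise ≈-mod-refl ≈-mod-refl ≈-mod-refl ≈-mod-refl

  ⊗-cong-mod : ∀ {X X′ Y Y′} → X ≅ X′ [mod N ] → Y ≅ Y′ [mod N ] → X ⊗ Y ≅ X′ ⊗ Y′ [mod N ]
  ⊗-cong-mod (entrywise a b c d) (entrywise e f g h) =
    entrywise (entry a b e g) (entry a b f h) (entry c d e g) (entry c d f h)
    where
    entry : ∀ {x x′ y y′ u u′ v v′} →
            x ≈ x′ [mod N ] → y ≈ y′ [mod N ] → u ≈ u′ [mod N ] → v ≈ v′ [mod N ] →
            x · u + y · v ≈ x′ · u′ + y′ · v′ [mod N ]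
    entry x y u v = +-cong-mod (·-cong-mod x u) (·-cong-mod y v)

  A-cong-mod : ∀ {x y} → x ≈ y [mod N ] → A x ≅ A y [mod N ]
  A-cong-mod x≈y = entrywise x≈y ≈-mod-refl ≈-mod-refl ≈-mod-refl

  Mgo-cong-mod : ∀ {X Y xs ys} → X ≅ Y [mod N ] → Pointwise (_≈_[mod N ]) xs ys → Mgo X xs ≅ Mgo Y ys [mod N ]
  Mgo-cong-mod X≅Y [] = X≅Y
  Mgo-cong-mod X≅Y (x≈y ∷ xs≈ys) = Mgo-cong-mod (⊗-cong-mod (A-cong-mod x≈y) X≅Y) xs≈ys

  Mₙ-cong-mod : ∀ {xs ys} → Pointwise (_≈_[mod N ]) xs ys → Mₙ xs ≅ Mₙ ys [mod N ]
  Mₙ-cong-mod = Mgo-cong-mod ≅-refl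

  ≋⇒≅ : ∀ {X Y} → X ≋[mod N ] Y → X ≅ Y [mod N ]
  ≋⇒≅ (a , b , c , d) = entrywise (≡[mod]⇒≈ a) (≡[mod]⇒≈ b) (≡[mod]⇒≈ c) (≡[mod]⇒≈ d)

  ≅⇒≋ : ∀ {X Y} → X ≅ Y [mod N ] → X ≋[mod N ] Y
  ≅⇒≋ (entrywise a b c d) = ≈⇒≡[mod] a , ≈⇒≡[mod] b , ≈⇒≡[mod] c , ≈⇒≡[mod] d

scalar : ℤ → Mat
scalar e = mat e (+ 0) (+ 0) e

solution⇒scalar : ∀ {N as} → IsSolution N as → ∃[ e ] ∣ e ∣ ≡ 1 × Mₙ as ≅ scalar e [mod N ]
solution⇒scalar (inj₁ M≋Id) = + 1 , refl , ≋⇒≅ M≋Id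
solution⇒scalar (inj₂ M≋-Id) = - + 1 , refl , ≋⇒≅ M≋-Id

scalar⇒solution : ∀ {N as e} → ∣ e ∣ ≡ 1 → Mₙ as ≅ scalar e [mod N ] → IsSolution N as
scalar⇒solution {e = e} u M≅ with unit⇒±1 e u
... | inj₁ refl = inj₁ (≅⇒≋ M≅)
... | inj₂ refl = inj₂ (≅⇒≋ M≅)

-- The sequence U

-- U k j is the Chebyshev polynomial of the second kind U_{j-1}(k/2).
U : ℤ → ℕ → ℤ
U k zero = + 0
U k (suc zero) = + 1
U k (suc (suc j)) = k · U k (suc j) - U k j

Mₙ-replicate : ∀ k j → Mₙ (replicate j k) ≡ mat (U k (suc j)) (- U k j) (U k j) (U k (suc j) - k · U k j)
Mₙ-replicate k zero = cong (mat (+ 1) (+ 0) (+ 0)) (identity k)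
  where
  identity : ∀ k → + 1 ≡ + 1 - k · + 0
  identity = solve-∀
Mₙ-replicate k (suc j) = begin
  Mₙ (replicate (suc j) k)                         ≡⟨ Mₙ-∷ k (replicate j k) ⟩
  Mₙ (replicate j k) ⊗ A k                         ≡⟨ cong (_⊗ A k) (Mₙ-replicate k j) ⟩
  mat (U k (suc j)) (- U k j) (U k j) (U k (suc j) - k · U k j) ⊗ A k
    ≡⟨ step (U k j) (U k (suc j)) ⟩
  mat (U k (suc (suc j))) (- U k (suc j)) (U k (suc j)) (U k (suc (suc j)) - k · U k (suc j)) ∎
  where
  open ≡-Reasoning
  step : ∀ u₀ u₁ →
         mat u₁ (- u₀) u₀ (u₁ - k · u₀) ⊗ A k ≡ mat (k · u₁ - u₀) (- u₁) u₁ ((k · u₁ - u₀) - k · u₁)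
  step u₀ u₁ = mat-≡ (e₁₁ k u₀ u₁) (e₁₂ k u₀ u₁) (e₂₁ k u₀ u₁) (e₂₂ k u₀ u₁)
    where
    e₁₁ : ∀ k u₀ u₁ → u₁ · k + (- u₀) · + 1 ≡ k · u₁ - u₀
    e₁₁ = solve-∀
    e₁₂ : ∀ k u₀ u₁ → u₁ · (- + 1) + (- u₀) · + 0 ≡ - u₁
    e₁₂ = solve-∀
    e₂₁ : ∀ k u₀ u₁ → u₀ · k + (u₁ - k · u₀) · + 1 ≡ u₁
    e₂₁ = solve-∀
    e₂₂ : ∀ k u₀ u₁ → u₀ · (- + 1) + (u₁ - k · u₀) · + 0 ≡ (k · u₁ - u₀) - k · u₁
    e₂₂ = solve-∀

U-cassini : ∀ k j → U k j · U k (suc (suc j)) ≡ U k (suc j) · U k (suc j) - + 1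
U-cassini k zero = identity (U k 2)
  where
  identity : ∀ u → + 0 · u ≡ + 1 · + 1 - + 1
  identity = solve-∀
U-cassini k (suc j) = begin
  u₁ · (k · u₂ - u₁)                  ≡⟨ expand k u₀ u₁ ⟩
  u₂ · u₂ + u₀ · u₂ - u₁ · u₁         ≡⟨ cong (λ t → u₂ · u₂ + t - u₁ · u₁) (U-cassini k j) ⟩
  u₂ · u₂ + (u₁ · u₁ - + 1) - u₁ · u₁ ≡⟨ cancel (u₂ · u₂) (u₁ · u₁) ⟩
  u₂ · u₂ - + 1                       ∎
  where
  open ≡-Reasoning
  u₀ = U k j
  u₁ = U k (suc j)
  u₂ = U k (suc (suc j))
  expand : ∀ k u₀ u₁ →
           u₁ · (k · (k · u₁ - u₀) - u₁) ≡ (k · u₁ - u₀) · (k · u₁ - u₀) + u₀ · (k · u₁ - u₀) - u₁ · u₁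
  expand = solve-∀
  cancel : ∀ x y → x + (y - + 1) - y ≡ x - + 1
  cancel = solve-∀

U-+3 : ∀ k → k · k ≡ + 1 → ∀ j → U k (3 ℕ.+ j) ≡ - k · U k j
U-+3 k k²≡1 j = begin
  k · (k · u₁ - u₀) - u₁   ≡⟨ expand k u₀ u₁ ⟩
  (k · k - + 1) · u₁ - k · u₀ ≡⟨ cong (λ t → (t - + 1) · u₁ - k · u₀) k²≡1 ⟩
  (+ 1 - + 1) · u₁ - k · u₀   ≡⟨ collapse k u₀ u₁ ⟩
  - k · u₀                    ∎
  where
  open ≡-Reasoning
  u₀ = U k j
  u₁ = U k (suc j)
  expand : ∀ k u₀ u₁ → k · (k · u₁ - u₀) - u₁ ≡ (k · k - + 1) · u₁ - k · u₀
  expand = solve-∀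
  collapse : ∀ k u₀ u₁ → (+ 1 - + 1) · u₁ - k · u₀ ≡ - k · u₀
  collapse = solve-∀

U-unit : ∀ k → ∣ k ∣ ≡ 1 → ∀ i → ∣ U k (1 ℕ.+ i * 3) ∣ ≡ 1 × ∣ U k (2 ℕ.+ i * 3) ∣ ≡ 1
U-unit k u zero = refl , trans (cong ∣_∣ (identity k)) u
  where
  identity : ∀ k → k · + 1 - + 0 ≡ k
  identity = solve-∀
U-unit k u (suc i) = shift (1 ℕ.+ i * 3) (proj₁ (U-unit k u i)) , shift (2 ℕ.+ i * 3) (proj₂ (U-unit k u i))
  where
  shift : ∀ j → ∣ U k j ∣ ≡ 1 → ∣ U k (3 ℕ.+ j) ∣ ≡ 1
  shift j v = begin
    ∣ U k (3 ℕ.+ j) ∣      ≡⟨ cong ∣_∣ (U-+3 k (unit-square k u) j) ⟩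
    ∣ - k · U k j ∣        ≡⟨ ℤP.abs-* (- k) (U k j) ⟩
    ∣ - k ∣ ℕ.* ∣ U k j ∣  ≡⟨ cong₂ ℕ._*_ (unit-neg k u) v ⟩
    1                      ∎
    where open ≡-Reasoning

U-cong-mod : ∀ {N k k′} → k ≈ k′ [mod N ] →
             ∀ j → U k j ≈ U k′ j [mod N ] × U k (suc j) ≈ U k′ (suc j) [mod N ]
U-cong-mod k≡k′ zero = ≈-mod-refl , ≈-mod-refl
U-cong-mod k≡k′ (suc j) with U-cong-mod k≡k′ j
... | u₀ , u₁ = u₁ , +-cong-mod (·-cong-mod k≡k′ u₁) (-‿cong-mod u₀)

solution⇒U≡0 : ∀ {N k j} → IsSolution N (replicate j k) → U k j ≈ + 0 [mod N ]
solution⇒U≡0 {N} {k} {j} sol with solution⇒scalar {as = replicate j k} sol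
... | e , _ , M≅ = _≅_[mod_].e₂₁ (subst (_≅ scalar e [mod N ]) (Mₙ-replicate k j) M≅)

U-zero⇒solution : ∀ {N k j e} → ∣ e ∣ ≡ 1 → U k j ≈ + 0 [mod N ] → U k (suc j) ≈ e [mod N ] →
                  IsSolution N (replicate j k)
U-zero⇒solution {N} {k} {j} {e} u U₀≡0 U₁≡e =
  scalar⇒solution {as = replicate j k} u (subst (_≅ scalar e [mod N ]) (sym (Mₙ-replicate k j))
    (entrywise U₁≡e (-‿cong-mod U₀≡0) U₀≡0 corner))
  where
  identity : ∀ e k → e - k · + 0 ≡ e
  identity = solve-∀
  corner : U k (suc j) - k · U k j ≈ e [mod N ]
  corner = ≈-mod-trans (+-cong-mod U₁≡e (-‿cong-mod (·-cong-mod (≈-mod-refl {x = k}) U₀≡0)))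
                       (≈-mod-reflexive (identity e k))

U-cassini-mod : ∀ {N} k j {e} → ∣ e ∣ ≡ 1 → U k (suc j) ≈ e [mod N ] →
                N ∣ ∣ U k j ∣ ℕ.* ∣ U k (suc (suc j)) ∣
U-cassini-mod {N} k j {e} u U₁≡e =
  subst (N ∣_) (ℤP.abs-* (U k j) (U k (suc (suc j))))
    (subst (λ z → N ∣ ∣ z ∣) (sym (U-cassini k j))
      (≈⇒≡[mod] (≈-mod-trans (·-cong-mod U₁≡e U₁≡e) (≈-mod-reflexive (unit-square e u)))))

coprime⇒prime∤ : ∀ {m n p} → Coprime m n → Prime p → p ∣ n → ¬ p ∣ m
coprime⇒prime∤ cop pp p∣n p∣m = ¬prime[1] (subst Prime (cop (p∣m , p∣n)) pp)

no-common-prime⇒coprime : ∀ {m n} .{{_ : NonZero n}} → (∀ {p} → Prime p → p ∣ n → ¬ p ∣ m) → Coprime m n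
no-common-prime⇒coprime {n = n} no-p {zero} (_ , 0∣n) = ⊥-elim (ℕ.≢-nonZero⁻¹ n (ℕ∣.0∣⇒≡0 0∣n))
no-common-prime⇒coprime no-p {suc d} (d∣m , d∣n) with factorise (suc d)
... | record { factors = [] ; isFactorisation = d≡1 } = d≡1
... | record { factors = p ∷ ps ; isFactorisation = d≡p*ps ; factorsPrime = pp ∷ _ } =
  ⊥-elim (no-p pp (ℕ∣.∣-trans p∣d d∣n) (ℕ∣.∣-trans p∣d d∣m))
  where
  p∣d : p ∣ suc d
  p∣d = subst (p ∣_) (sym d≡p*ps) (ℕ∣.m∣m*n _)

prime∣prime⇒≡ : ∀ {p q} → Prime p → Prime q → p ∣ q → p ≡ q
prime∣prime⇒≡ pp pq p∣q with prime⇒irreducible pq p∣q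
... | inj₁ refl = ⊥-elim (¬prime[1] pp)
... | inj₂ p≡q = p≡q

prime∣^⇒∣ : ∀ {p q} c → Prime p → p ∣ q ^ c → p ∣ q
prime∣^⇒∣ zero pp p∣1 = ⊥-elim (¬prime[1] (subst Prime (ℕ∣.∣1⇒≡1 p∣1) pp))
prime∣^⇒∣ {q = q} (suc c) pp p∣q^c = [ id , prime∣^⇒∣ c pp ] (euclidsLemma q (q ^ c) pp p∣q^c)

PlusMinusOneModPrimeDivisors : ℕ → ℤ → Set
PlusMinusOneModPrimeDivisors N k = ∀ {p} → Prime p → p ∣ N → ∃[ k₀ ] ∣ k₀ ∣ ≡ 1 × k ≈ k₀ [mod p ]

data Residue3 : ℕ → Set where
  rem0 : ∀ i → Residue3 (i * 3)
  rem1 : ∀ i → Residue3 (1 ℕ.+ i * 3)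
  rem2 : ∀ i → Residue3 (2 ℕ.+ i * 3)

residue3 : ∀ j → Residue3 j
residue3 zero = rem0 0
residue3 (suc zero) = rem1 0
residue3 (suc (suc zero)) = rem2 0
residue3 (suc (suc (suc j))) with residue3 j
... | rem0 i = rem0 (suc i)
... | rem1 i = rem1 (suc i)
... | rem2 i = rem2 (suc i)

module _ {N k} .{{_ : NonZero N}} (±1-mod-p : PlusMinusOneModPrimeDivisors N k) where

  U-coprime : ∀ j → (∀ k₀ → ∣ k₀ ∣ ≡ 1 → ∣ U k₀ j ∣ ≡ 1) → Coprime ∣ U k j ∣ N
  U-coprime j unit-at-±1 = no-common-prime⇒coprime λ pp p∣N → case pp (±1-mod-p pp p∣N)
    where
    case : ∀ {p} → Prime p → ∃[ k₀ ] ∣ k₀ ∣ ≡ 1 × k ≈ k₀ [mod p ] → ¬ p ∣ ∣ U k j ∣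
    case pp (k₀ , u , k≡k₀) = unit-≈-mod-prime pp (proj₁ (U-cong-mod k≡k₀ j)) (unit-at-±1 k₀ u)

  -- j and j + 2 are never both divisible by 3.
  U-coprime-or : ∀ j → Coprime (∣ U k j ∣) N ⊎ Coprime (∣ U k (2 ℕ.+ j) ∣) N
  U-coprime-or j with residue3 j
  ... | rem0 i = inj₂ (U-coprime (2 ℕ.+ i * 3) (λ k₀ u → proj₂ (U-unit k₀ u i)))
  ... | rem1 i = inj₁ (U-coprime (1 ℕ.+ i * 3) (λ k₀ u → proj₁ (U-unit k₀ u i)))
  ... | rem2 i = inj₂ (U-coprime (1 ℕ.+ suc i * 3) (λ k₀ u → proj₁ (U-unit k₀ u (suc i))))

  U-unit⇒solution : ∀ j {e} → ∣ e ∣ ≡ 1 → U k (suc j) ≈ e [mod N ] →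
                    IsSolution N (replicate j k) ⊎ IsSolution N (replicate (2 ℕ.+ j) k)
  U-unit⇒solution j {e} u U₁≡e with U-coprime-or j
  ... | inj₂ cop = inj₁ (U-zero⇒solution {k = k} {j} u (∣⇒≈-mod-0 N∣U₀) U₁≡e)
    where
    N∣U₀ : N ∣ ∣ U k j ∣
    N∣U₀ = coprime-divisor (Coprimality.sym cop)
             (subst (N ∣_) (ℕP.*-comm ∣ U k j ∣ _) (U-cassini-mod k j u U₁≡e))
  ... | inj₁ cop = inj₂ (U-zero⇒solution {k = k} {2 ℕ.+ j} (unit-neg e u) (∣⇒≈-mod-0 N∣U₂) U₃≡-e)
    where
    N∣U₂ : N ∣ ∣ U k (2 ℕ.+ j) ∣
    N∣U₂ = coprime-divisor (Coprimality.sym cop) (U-cassini-mod k j u U₁≡e)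
    identity : ∀ k e → k · + 0 - e ≡ - e
    identity = solve-∀
    U₃≡-e : U k (3 ℕ.+ j) ≈ - e [mod N ]
    U₃≡-e = ≈-mod-trans (+-cong-mod (·-cong-mod (≈-mod-refl {x = k}) (∣⇒≈-mod-0 N∣U₂)) (-‿cong-mod U₁≡e))
                        (≈-mod-reflexive (identity k e))

-- Reductions of monomial solutions

rotate-↭ : ∀ i xs → rotate i xs ↭ xs
rotate-↭ i xs = ↭-trans (++-comm (drop i xs) (take i xs)) (↭-reflexive (ListP.take++drop≡id i xs))

∼⇒↭-Pointwise : ∀ {N c d} → c ∼[mod N ] d →
                ∃[ xs ] xs ↭ c × Pointwise (λ x y → x ≡[mod N ] y) xs d
∼⇒↭-Pointwise {c = c} (i , _ , inj₁ pw) = rotate i c , rotate-↭ i c , pw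
∼⇒↭-Pointwise {c = c} (i , _ , inj₂ pw) = rotate i (reverse c) , ↭-trans (rotate-↭ i _) (↭-reverse c) , pw

All-≡⇒All-≈ : ∀ {N k xs ys} → All (_≡ k) xs → Pointwise (λ x y → x ≡[mod N ] y) xs ys →
              All (k ≈_[mod N ]) ys
All-≡⇒All-≈ [] [] = []
All-≡⇒All-≈ (refl ∷ hs) (x≡y ∷ xs≡ys) = ≡[mod]⇒≈ x≡y ∷ All-≡⇒All-≈ hs xs≡ys

All-≈⇒Pointwise : ∀ {N k xs} → All (k ≈_[mod N ]) xs → Pointwise (_≈_[mod N ]) (replicate (length xs) k) xs
All-≈⇒Pointwise [] = []
All-≈⇒Pointwise (k≡x ∷ hs) = k≡x ∷ All-≈⇒Pointwise hs

replicate-∼ : ∀ {N L k d} → replicate L k ∼[mod N ] d → length d ≡ L × All (k ≈_[mod N ]) d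
replicate-∼ {L = L} {k} c∼d with ∼⇒↭-Pointwise c∼d
... | xs , xs↭c , xs≡d =
  trans (sym (Pointwise-length xs≡d)) (trans (↭-length xs↭c) (ListP.length-replicate L)) ,
  All-≡⇒All-≈ (All-resp-↭ (↭-sym xs↭c) (replicate⁺ L refl)) xs≡d

unsnoc-∷ʳ : ∀ xs x → unsnoc (xs ∷ʳ x) ≡ just (xs , x)
unsnoc-∷ʳ [] x = refl
unsnoc-∷ʳ (y ∷ ys) x rewrite unsnoc-∷ʳ ys x = refl

⊕-∷ʳ : ∀ a₁ as aₙ b₁ bs bₘ → (a₁ ∷ as ∷ʳ aₙ) ⊕ (b₁ ∷ bs ∷ʳ bₘ) ≡ (a₁ + bₘ) ∷ as ++ (aₙ + b₁) ∷ bs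
⊕-∷ʳ a₁ as aₙ b₁ bs bₘ rewrite unsnoc-∷ʳ as aₙ | unsnoc-∷ʳ bs bₘ = refl

length-∷ʳ : ∀ xs (x : ℤ) → length (xs ∷ʳ x) ≡ suc (length xs)
length-∷ʳ xs x = trans (ListP.length-++ xs) (ℕP.+-comm (length xs) 1)

⊕-middle : ∀ {P : ℤ → Set} a b → 3 ≤ length a → 3 ≤ length b → All P (a ⊕ b) →
           ∃[ b₁ ] ∃[ bs ] ∃[ bₘ ] b ≡ b₁ ∷ bs ∷ʳ bₘ × 1 ≤ length bs ×
                                   3 ℕ.+ length bs ≤ length (a ⊕ b) × All P bs
⊕-middle (a₁ ∷ as) (b₁ ∷ bs) (s≤s 2≤as) (s≤s 2≤bs) all with reverseView as | reverseView bs
... | amid ∶ _ ∶ʳ aₙ | bmid ∶ _ ∶ʳ bₘ rewrite ⊕-∷ʳ a₁ amid aₙ b₁ bmid bₘ =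
  b₁ , bmid , bₘ , refl , shrink bmid bₘ 2≤bs , bound , All.tail (++⁻ʳ ((a₁ + bₘ) ∷ amid) all)
  where
  shrink : ∀ xs x → 2 ≤ length (xs ∷ʳ x) → 1 ≤ length xs
  shrink xs x h = ℕ.s≤s⁻¹ (subst (2 ≤_) (length-∷ʳ xs x) h)
  bound : 3 ℕ.+ length bmid ≤ suc (length (amid ++ (aₙ + b₁) ∷ bmid))
  bound = subst (λ n → 3 ℕ.+ length bmid ≤ suc n) (sym (ListP.length-++ amid))
            (s≤s (ℕP.+-monoˡ-≤ (suc (length bmid)) (shrink amid aₙ 2≤as)))

reduction⇒U-unit : ∀ {N k L} a b → IsSolution N b → 3 ≤ length b → 3 ≤ length a →
                   replicate L k ∼[mod N ] (a ⊕ b) →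
                   ∃[ j ] 1 ≤ j × 3 ℕ.+ j ≤ L × ∃[ e ] ∣ e ∣ ≡ 1 × U k (suc j) ≈ e [mod N ]
reduction⇒U-unit {N} {k} {L} a b sol 3≤b 3≤a c∼ab with replicate-∼ c∼ab
... | length≡L , all with ⊕-middle a b 3≤a 3≤b all
... | b₁ , bs , bₘ , refl , 1≤bs , bound , all-bs with solution⇒scalar {as = b₁ ∷ bs ∷ʳ bₘ} sol
... | e , u , M≅ = length bs , 1≤bs , subst (3 ℕ.+ length bs ≤_) length≡L bound , - e , unit-neg e u , U≡-e
  where
  U≡m11 : U k (suc (length bs)) ≈ Mat.m11 (Mₙ bs) [mod N ]
  U≡m11 = _≅_[mod_].e₁₁ (subst (_≅ Mₙ bs [mod N ]) (Mₙ-replicate k (length bs))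
                                (Mₙ-cong-mod (All-≈⇒Pointwise all-bs)))
  U≡-e : U k (suc (length bs)) ≈ - e [mod N ]
  U≡-e = ≈-mod-trans U≡m11 (≈-mod-trans (≈-mod-reflexive (sym (Mₙ-frame b₁ bs bₘ)))
                                         (-‿cong-mod (_≅_[mod_].e₂₂ M≅)))

monomial-solution-length≥3 : ∀ {N k L} → 2 ≤ N → Coprime ∣ k ∣ N → 1 ≤ L → IsSolution N (replicate L k) →
                             3 ≤ L
monomial-solution-length≥3 {N} {k} {L} 2≤N cop 1≤L sol =
  go L 1≤L (≈-mod-0⇒∣ (solution⇒U≡0 {k = k} {j = L} sol))
  where
  identity : ∀ k → k · + 1 - + 0 ≡ k
  identity = solve-∀
  go : ∀ L → 1 ≤ L → N ∣ ∣ U k L ∣ → 3 ≤ L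
  go 1 _ N∣1 = ⊥-elim (ℕP.<⇒≢ 2≤N (sym (ℕ∣.∣1⇒≡1 N∣1)))
  go 2 _ N∣U₂ = ⊥-elim (ℕP.<⇒≢ 2≤N (sym (cop (subst (λ z → N ∣ ∣ z ∣) (identity k) N∣U₂ , ℕ∣.∣-refl))))
  go (suc (suc (suc _))) _ _ = s≤s (s≤s (s≤s z≤n))

quasiMonomiallyIrreducible : ∀ {N} → 2 ≤ N → (∀ k → Coprime ∣ k ∣ N → PlusMinusOneModPrimeDivisors N k) →
                             QuasiMonomiallyIrreducible N
quasiMonomiallyIrreducible {N} 2≤N ±1-mod-p k cop L (1≤L , sol , minimal) =
  subst (3 ≤_) (sym (ListP.length-replicate L)) (monomial-solution-length≥3 2≤N cop 1≤L sol) , sol , irreducible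
  where
  instance
    nonZero : NonZero N
    nonZero = ℕ.>-nonZero (ℕP.<-trans (s≤s z≤n) 2≤N)
  irreducible : ¬ Reducible N (replicate L k)
  irreducible (_ , _ , b , a , sol-b , 3≤b , 3≤a , c∼ab) with reduction⇒U-unit a b sol-b 3≤b 3≤a c∼ab
  ... | j , 1≤j , 3+j≤L , e , u , U≡e with U-unit⇒solution (±1-mod-p k cop) j {e} u U≡e
  ... | inj₁ sol-j = minimal j 1≤j (ℕP.≤-trans (ℕP.n≤1+n _) (ℕP.≤-trans (ℕP.n≤1+n _) 3+j≤L)) sol-j
  ... | inj₂ sol-2+j = minimal (2 ℕ.+ j) (s≤s z≤n) 3+j≤L sol-2+j

-- The case N = 2^a 3^b

≈-mod-%ℕ : ∀ k p .{{_ : NonZero p}} → k ≈ + (k %ℕ p) [mod p ]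
≈-mod-%ℕ k p = mod (ℤ∣.divides (k /ℕ p) (begin
    k - + (k %ℕ p)                             ≡⟨ cong (_- + (k %ℕ p)) (a≡a%ℕn+[a/ℕn]*n k p) ⟩
    (+ (k %ℕ p) + (k /ℕ p) · + p) - + (k %ℕ p) ≡⟨ identity (+ (k %ℕ p)) (k /ℕ p) (+ p) ⟩
    (k /ℕ p) · + p                             ∎))
  where
  open ≡-Reasoning
  identity : ∀ r q p → (r + q · p) - r ≡ q · p
  identity = solve-∀

prime-divisor-2^a3^b : ∀ a b {p} → Prime p → p ∣ 2 ^ a * 3 ^ b → p ≡ 2 ⊎ p ≡ 3
prime-divisor-2^a3^b a b pp p∣N with euclidsLemma (2 ^ a) (3 ^ b) pp p∣N
... | inj₁ p∣2^a = inj₁ (prime∣prime⇒≡ pp prime[2] (prime∣^⇒∣ a pp p∣2^a))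
... | inj₂ p∣3^b = inj₂ (prime∣prime⇒≡ pp (from-yes (prime? 3)) (prime∣^⇒∣ b pp p∣3^b))

±1-mod-2 : ∀ k → ¬ 2 ∣ ∣ k ∣ → k ≈ + 1 [mod 2 ]
±1-mod-2 k 2∤k with k %ℕ 2 | n%ℕd<d k 2 | ≈-mod-%ℕ k 2
... | 0 | _ | k≡0 = ⊥-elim (2∤k (≈-mod-0⇒∣ k≡0))
... | 1 | _ | k≡1 = k≡1
... | suc (suc _) | s≤s (s≤s ()) | _

±1-mod-3 : ∀ k → ¬ 3 ∣ ∣ k ∣ → k ≈ + 1 [mod 3 ] ⊎ k ≈ - + 1 [mod 3 ]
±1-mod-3 k 3∤k with k %ℕ 3 | n%ℕd<d k 3 | ≈-mod-%ℕ k 3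
... | 0 | _ | k≡0 = ⊥-elim (3∤k (≈-mod-0⇒∣ k≡0))
... | 1 | _ | k≡1 = inj₁ k≡1
... | 2 | _ | k≡2 = inj₂ (≈-mod-trans k≡2 (mod (ℤ∣.divides (+ 1) refl)))
... | suc (suc (suc _)) | s≤s (s≤s (s≤s ())) | _

±1-mod-prime-divisors-2^a3^b : ∀ a b k → Coprime ∣ k ∣ (2 ^ a * 3 ^ b) →
                               PlusMinusOneModPrimeDivisors (2 ^ a * 3 ^ b) k
±1-mod-prime-divisors-2^a3^b a b k cop {p} pp p∣N =
  residue (prime-divisor-2^a3^b a b pp p∣N) (coprime⇒prime∤ cop pp p∣N)
  where
  residue : p ≡ 2 ⊎ p ≡ 3 → ¬ p ∣ ∣ k ∣ → ∃[ k₀ ] ∣ k₀ ∣ ≡ 1 × k ≈ k₀ [mod p ]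
  residue (inj₁ refl) p∤k = + 1 , refl , ±1-mod-2 k p∤k
  residue (inj₂ refl) p∤k =
    [ (λ k≡1 → + 1 , refl , k≡1) , (λ k≡-1 → - + 1 , refl , k≡-1) ] (±1-mod-3 k p∤k)

proposition3p8 : ∀ (n m : ℕ) → 2 ≤ 2 ^ n * 3 ^ m → QuasiMonomiallyIrreducible (2 ^ n * 3 ^ m)
proposition3p8 n m 2≤N = quasiMonomiallyIrreducible 2≤N (±1-mod-prime-divisors-2^a3^b n m)
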